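{- Let $c\in\omega^\omega$. The graph $\mathbb L_c$ has no cycles, and all vertices of $\mathbb L_c$ have degree $2$ except for the vertex $(0,0,0^\omega)$, which has degree $1$ (here $0^\omega$ is the constant zero sequence).
   Context: Finite paths: fix distinct symbols $p_0,p_1,\dots$; vertices are finite sequences $(p_k)^\frown t$, $t$ a finite binary string. For $c\in\omega^\omega$: $L^c_0$ has the single vertex $(p_0)$, no edges, endpoints $e^0_0=e^0_1=(p_0)$. Given $L^c_n$, $L^c_{n+1}$ has vertices $v^\frown(i)$ ($v\in V(L^c_n)$, $i<2$) and new vertices $(p_0),\dots,(p_{c(n)})$; edges $\{v^\frown(i),w^\frown(i)\}$ for each edge $\{v,w\}$ of $L^c_n$, $i<2$, plus the edges of the path $(e^n_1{}^\frown(0),(p_0),\dots,(p_{c(n)}),e^n_1{}^\frown(1))$; endpoints $e^{n+1}_i=e^n_0{}^\frown(i)$. The graph $\mathbb L_c$: $X_c$ is the set of $(m,k,x)\in\mathbb N\times\mathbb N\times2^{\mathbb N}$ with either $m=k=0$, or $m\geq1$ and $k\leq c(m-1)$. For $n\geq m$, $\pi_n(m,k,x)=(p_k)^\frown(x\restriction(n-m))\in V(L^c_n)$. Vertices $(n_0,k_0,x_0),(n_1,k_1,x_1)$ are adjacent in $\mathbb L_c$ iff $\pi_n(n_0,k_0,x_0),\pi_n(n_1,k_1,x_1)$ are adjacent in $L^c_n$ for all $n\geq\max\{n_0,n_1\}$. -}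

module Defs where

open import Data.Nat using (ℕ; zero; suc; _≤_; _<_; _∸_; _⊔_)
open import Data.Bool using (Bool; true; false)
open import Data.List using (List; []; _∷ʳ_)
open import Data.Product using (_×_; _,_; Σ; ∃; ∃-syntax)
open import Data.Sum using (_⊎_; inj₁; inj₂)
open import Relation.Binary.PropositionalEquality using (_≡_; _≢_; refl)
open import Relation.Nullary using (¬_)

Cantor : Set
Cantor = ℕ → Bool

-- A vertex (p_k)⌢t of the finite paths is represented as the pair (k , t).
FVtx : Set
FVtx = ℕ × List Bool

snocV : FVtx → Bool → FVtx
snocV (k , t) i = (k , t ∷ʳ i)

-- endpoints e^n_0 and e^n_1 of L^c_n
e₀ : ℕ → FVtx
e₀ zero    = (0 , [])
e₀ (suc n) = snocV (e₀ n) false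

e₁ : ℕ → FVtx
e₁ zero    = (0 , [])
e₁ (suc n) = snocV (e₀ n) true

-- Edge c n v w : {v , w} is an edge of L^c_n (edges listed in one orientation)
data Edge (c : ℕ → ℕ) : ℕ → FVtx → FVtx → Set where
  lift  : ∀ {n v w} → Edge c n v w → (i : Bool) →
          Edge c (suc n) (snocV v i) (snocV w i)
  pathˡ : ∀ {n} → Edge c (suc n) (snocV (e₁ n) false) (0 , [])
  pathᵐ : ∀ {n j} → j < c n → Edge c (suc n) (j , []) (suc j , [])
  pathʳ : ∀ {n} → Edge c (suc n) (c n , []) (snocV (e₁ n) true)

AdjL : (c : ℕ → ℕ) → ℕ → FVtx → FVtx → Set
AdjL c n v w = Edge c n v w ⊎ Edge c n w v

record XVtx (c : ℕ → ℕ) : Set where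
  constructor ⟨_,_,_∣_⟩
  field
    m : ℕ
    k : ℕ
    x : Cantor
    valid : (m ≡ 0 × k ≡ 0) ⊎ (1 ≤ m × k ≤ c (m ∸ 1))
open XVtx public

restrict : Cantor → ℕ → List Bool
restrict x zero    = []
restrict x (suc j) = restrict x j ∷ʳ x j

-- π_n(m,k,x) = (p_k)⌢(x ↾ (n - m))   (used for n ≥ m)
π : ∀ {c} → ℕ → XVtx c → FVtx
π n v = (k v , restrict (x v) (n ∸ m v))

Adj : (c : ℕ → ℕ) → XVtx c → XVtx c → Set
Adj c u v = ∀ n → m u ⊔ m v ≤ n → AdjL c n (π n u) (π n v)

_≈_ : ∀ {c} → XVtx c → XVtx c → Set
u ≈ v = m u ≡ m v × k u ≡ k v × (∀ i → x u i ≡ x v i)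

_#_ : ∀ {c} → XVtx c → XVtx c → Set
u # v = m u ≢ m v ⊎ k u ≢ k v ⊎ ∃[ i ] (x u i ≢ x v i)

base : ∀ {c} → XVtx c
base = ⟨ 0 , 0 , (λ _ → false) ∣ inj₁ (refl , refl) ⟩

HasCycle : (c : ℕ → ℕ) → Set
HasCycle c = ∃[ L ] Σ (ℕ → XVtx c) λ f →
    3 ≤ L
  × (∀ i → suc i < L → Adj c (f i) (f (suc i)))
  × Adj c (f (L ∸ 1)) (f 0)
  × (∀ i j → i < j → j < L → ¬ (f i ≈ f j))

Degree2 : (c : ℕ → ℕ) → XVtx c → Set
Degree2 c v = ∃[ u ] ∃[ w ]
    Adj c v u × Adj c v w × ¬ (u ≈ w)
  × (∀ z → Adj c v z → z ≈ u ⊎ z ≈ w)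

Degree1 : (c : ℕ → ℕ) → XVtx c → Set
Degree1 c v = ∃[ u ] Adj c v u × (∀ z → Adj c v z → z ≈ u)

{-# OPTIONS --safe #-}
module Submission where

-- Each L^c_n is a path, so its vertices can be numbered 0, …, S_n along it with adjacent vertices
-- one apart. A vertex of 𝕃_c is determined by its number at any level above its own together with
-- the bits it appends from there on, and adjacent vertices append the same bits. So the neighbours
-- of a vertex, read at a common level, are numbered one apart from it: there are at most two, only
-- one for (0,0,0^ω), which is numbered 0 at every level, and on a cycle the two neighbours of a
-- vertex with the largest number would coincide. Two neighbours of the other vertices are exhibited.

open import Defs
open import Data.Bool using (Bool; true; false)
open import Data.Bool.Properties using (¬-not)
open import Data.Empty using (⊥)
open import Data.List using (List; []; _∷_; _∷ʳ_; reverse; length)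
open import Data.List.Properties using (reverse-++; reverse-injective; ∷ʳ-injective; ∷ʳ-injectiveʳ; length-++)
open import Data.Nat using (ℕ; zero; suc; _+_; _∸_; _⊔_; _≤_; _<_; z≤n; s≤s; _<?_)
open import Data.Nat.Properties
open import Data.Product using (_×_; _,_; proj₁; proj₂; ∃-syntax)
open import Data.Sum using (_⊎_; inj₁; inj₂; [_,_]′) renaming (map to ⊎-map)
open import Function using (_∘_)
open import Relation.Binary.PropositionalEquality
open import Relation.Nullary using (¬_; yes; no; contradiction)

OneApart : ℕ → ℕ → Set
OneApart a b = suc a ≡ b ⊎ suc b ≡ a

OneApart-sym : ∀ {a b} → OneApart a b → OneApart b a
OneApart-sym (inj₁ e) = inj₂ e
OneApart-sym (inj₂ e) = inj₁ e

OneApart-+ˡ : ∀ o {a b} → OneApart a b → OneApart (o + a) (o + b)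
OneApart-+ˡ o (inj₁ refl) = inj₁ (sym (+-suc o _))
OneApart-+ˡ o (inj₂ refl) = inj₂ (sym (+-suc o _))

OneApart-∸ˡ : ∀ s {a b} → a ≤ s → b ≤ s → OneApart a b → OneApart (s ∸ a) (s ∸ b)
OneApart-∸ˡ (suc s) {a} _ (s≤s a≤s) (inj₁ refl) = inj₂ (sym (+-∸-assoc 1 a≤s))
OneApart-∸ˡ (suc s) {b = b} (s≤s b≤s) _ (inj₂ refl) = inj₁ (sym (+-∸-assoc 1 b≤s))

OneApart-0 : ∀ {q} → OneApart 0 q → q ≡ 1
OneApart-0 (inj₁ refl) = refl

OneApart-third : ∀ {p a b q} → OneApart p a → OneApart p b → a ≢ b → OneApart p q → q ≡ a ⊎ q ≡ b
OneApart-third (inj₁ refl) (inj₁ refl) a≢b _ = contradiction refl a≢b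
OneApart-third (inj₂ refl) (inj₂ refl) a≢b _ = contradiction refl a≢b
OneApart-third (inj₁ refl) (inj₂ refl) _ (inj₁ refl) = inj₁ refl
OneApart-third (inj₁ refl) (inj₂ refl) _ (inj₂ refl) = inj₂ refl
OneApart-third (inj₂ refl) (inj₁ refl) _ (inj₁ refl) = inj₂ refl
OneApart-third (inj₂ refl) (inj₁ refl) _ (inj₂ refl) = inj₁ refl

OneApart-peak : ∀ {a b d} → OneApart a b → OneApart b d → a ≤ b → d ≤ b → a ≡ d
OneApart-peak (inj₂ refl) _ a≤b _ = contradiction a≤b 1+n≰n
OneApart-peak (inj₁ refl) (inj₁ refl) _ d≤b = contradiction d≤b 1+n≰n
OneApart-peak (inj₁ refl) (inj₂ refl) _ _ = refl

argmax : (g : ℕ → ℕ) (L : ℕ) → ∃[ p ] p < suc L × (∀ i → i < suc L → g i ≤ g p)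
argmax g zero = 0 , s≤s z≤n , λ { zero _ → ≤-refl ; (suc _) (s≤s ()) }
argmax g (suc L) with argmax g L
... | p , p<L , max with ≤-total (g p) (g (suc L))
...   | inj₁ gp≤ = suc L , ≤-refl , λ i i<L →
  [ (λ i<L′ → ≤-trans (max i i<L′) gp≤) , (λ { refl → ≤-refl }) ]′ (m<1+n⇒m<n∨m≡n i<L)
...   | inj₂ ≤gp = p , m<n⇒m<1+n p<L , λ i i<L → [ max i , (λ { refl → ≤gp }) ]′ (m<1+n⇒m<n∨m≡n i<L)

-- The neighbours of a maximal value along the closed walk take the same value.
closed-walk-revisits : ∀ {L} (g : ℕ → ℕ) → 3 ≤ L →
                       (∀ i → suc i < L → OneApart (g i) (g (suc i))) → OneApart (g (L ∸ 1)) (g 0) →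
                       ∃[ i ] ∃[ j ] i < j × j < L × g i ≡ g j
closed-walk-revisits {suc (suc (suc L))} g (s≤s (s≤s (s≤s _))) step close with argmax g (suc (suc L))
... | zero , _ , max =
  1 , suc (suc L) , s≤s (s≤s z≤n) , ≤-refl ,
  sym (OneApart-peak close (step 0 (s≤s (s≤s z≤n))) (max _ ≤-refl) (max 1 (s≤s (s≤s z≤n))))
... | suc p , p<L , max with suc (suc p) <? suc (suc (suc L))
...   | yes p+2<L =
  p , suc (suc p) , s≤s (n≤1+n p) , p+2<L ,
  OneApart-peak (step p p<L) (step (suc p) p+2<L) (max p (<⇒≤ p<L)) (max _ p+2<L)
...   | no p+2≮L with ≤-antisym (≤-pred (≤-pred p<L)) (≤-pred (≤-pred (≮⇒≥ p+2≮L)))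
...     | refl =
  0 , suc L , s≤s z≤n , <⇒≤ p<L ,
  sym (OneApart-peak (step (suc L) p<L) close (max _ (<⇒≤ p<L)) (max 0 (s≤s z≤n)))

≥-induction : ∀ {ℓ} (P : ℕ → Set ℓ) {N} → P N → (∀ {n} → N ≤ n → P n → P (suc n)) →
              ∀ {n} → N ≤ n → P n
≥-induction P base step {zero} z≤n = base
≥-induction P base step {suc n} N≤1+n with m≤n⇒m<n∨m≡n N≤1+n
... | inj₁ (s≤s N≤n) = step N≤n (≥-induction P base step N≤n)
... | inj₂ refl = base

first-true : ∀ (z : Cantor) i → z i ≡ true → ∃[ j ] z j ≡ true × (∀ {l} → l < j → z l ≡ false)
first-true z i zi with z 0 in z0
... | true = 0 , z0 , λ ()
... | false with i | zi
...   | zero  | z0≡true = contradiction (trans (sym z0) z0≡true) λ ()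
...   | suc i | zi′ with first-true (λ l → z (suc l)) i zi′
...     | j , zj , below = suc j , zj , λ { {zero} _ → z0 ; {suc l} (s≤s l<j) → below l<j }

length-∷ʳ : ∀ {A : Set} (t : List A) b → length (t ∷ʳ b) ≡ suc (length t)
length-∷ʳ t b = trans (length-++ t) (+-comm (length t) 1)

reverse-∷ʳ : ∀ {A : Set} (t : List A) b → reverse (t ∷ʳ b) ≡ b ∷ reverse t
reverse-∷ʳ t b = reverse-++ t (b ∷ [])

[]≢∷ʳ : ∀ {A : Set} (t : List A) b → [] ≢ t ∷ʳ b
[]≢∷ʳ []      _ ()
[]≢∷ʳ (_ ∷ _) _ ()

length-restrict : ∀ z n → length (restrict z n) ≡ n
length-restrict z zero    = refl
length-restrict z (suc n) = trans (length-∷ʳ (restrict z n) (z n)) (cong suc (length-restrict z n))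

restrict-cong : ∀ {y z} n → (∀ {i} → i < n → y i ≡ z i) → restrict y n ≡ restrict z n
restrict-cong zero    _  = refl
restrict-cong (suc n) eq = cong₂ _∷ʳ_ (restrict-cong n (eq ∘ m<n⇒m<1+n)) (eq ≤-refl)

restrict-agree : ∀ {y z} n → restrict y n ≡ restrict z n → ∀ {i} → i < n → y i ≡ z i
restrict-agree (suc n) eq i<1+n with ∷ʳ-injective _ _ eq | m<1+n⇒m<n∨m≡n i<1+n
... | eq′ , _    | inj₁ i<n  = restrict-agree n eq′ i<n
... | _   , ynzn | inj₂ refl = ynzn

zeros : Cantor
zeros _ = false

cons : Bool → Cantor → Cantor
cons b y zero    = b
cons b y (suc i) = y i

prepend : List Bool → Cantor → Cantor
prepend []      y = y
prepend (b ∷ t) y = cons b (prepend t y)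

restrict-cons : ∀ b y n → restrict (cons b y) (suc n) ≡ b ∷ restrict y n
restrict-cons b y zero    = refl
restrict-cons b y (suc n) = cong (_∷ʳ y n) (restrict-cons b y n)

restrict-prepend : ∀ t y → restrict (prepend t y) (length t) ≡ t
restrict-prepend []      y = refl
restrict-prepend (b ∷ t) y = trans (restrict-cons b (prepend t y) (length t)) (cong (b ∷_) (restrict-prepend t y))

prepend-≥ : ∀ t y {l} → length t ≤ l → prepend t y l ≡ y (l ∸ length t)
prepend-≥ []      y _         = refl
prepend-≥ (b ∷ t) y (s≤s t≤l) = prepend-≥ t y t≤l

prepend-∷ʳ : ∀ t b y → prepend (t ∷ʳ b) y (length t) ≡ b
prepend-∷ʳ []      b y = refl
prepend-∷ʳ (_ ∷ t) b y = prepend-∷ʳ t b y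

module FinitePath (c : ℕ → ℕ) where

  -- The vertices of the path L^c_n are numbered along it from e^n_0 (number 0) to e^n_1 (number
  -- lastPos n). In L^c_{n+1} the copy of L^c_n with bit false keeps its numbers, p_0, …, p_{c n}
  -- follow, and the copy with bit true comes last, in reverse order from offset n on.
  lastPos : ℕ → ℕ
  lastPos zero    = 0
  lastPos (suc n) = suc (suc (lastPos n + c n)) + lastPos n

  offset : ℕ → ℕ
  offset n = suc (suc (lastPos n + c n))

  -- Bit strings are read from the last appended bit, hence stored reversed.
  positionʳ : ℕ → ℕ → List Bool → ℕ
  positionʳ zero    k r           = 0
  positionʳ (suc n) k []          = suc (lastPos n + k)
  positionʳ (suc n) k (false ∷ r) = positionʳ n k r
  positionʳ (suc n) k (true  ∷ r) = offset n + (lastPos n ∸ positionʳ n k r)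

  IsVertexʳ : ℕ → ℕ → List Bool → Set
  IsVertexʳ zero    k []      = k ≡ 0
  IsVertexʳ zero    k (_ ∷ _) = ⊥
  IsVertexʳ (suc n) k []      = k ≤ c n
  IsVertexʳ (suc n) k (_ ∷ r) = IsVertexʳ n k r

  position : ℕ → FVtx → ℕ
  position n (k , t) = positionʳ n k (reverse t)

  IsVertex : ℕ → FVtx → Set
  IsVertex n (k , t) = IsVertexʳ n k (reverse t)

  new<offset : ∀ n {k} → k ≤ c n → positionʳ (suc n) k [] < offset n
  positionʳ-≤ : ∀ n {k r} → IsVertexʳ n k r → positionʳ n k r ≤ lastPos n
  positionʳ-≤ zero    _ = z≤n
  positionʳ-≤ (suc n) {r = []}      k≤c = ≤-trans (<⇒≤ (new<offset n k≤c)) (m≤m+n (offset n) (lastPos n))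
  positionʳ-≤ (suc n) {r = false ∷ r} v = ≤-trans (positionʳ-≤ n v) (m≤n+m (lastPos n) (offset n))
  positionʳ-≤ (suc n) {k} {true ∷ r} _ = +-monoʳ-≤ (offset n) (m∸n≤m (lastPos n) (positionʳ n k r))

  new<offset n k≤c = s≤s (s≤s (+-monoʳ-≤ _ k≤c))

  copy₀<new : ∀ n {k r} k′ → IsVertexʳ n k r → positionʳ (suc n) k (false ∷ r) < positionʳ (suc n) k′ []
  copy₀<new n k′ v = s≤s (≤-trans (positionʳ-≤ n v) (m≤m+n _ k′))

  new<copy₁ : ∀ n {k} k′ r → k ≤ c n → positionʳ (suc n) k [] < positionʳ (suc n) k′ (true ∷ r)
  new<copy₁ n k′ r k≤c = <-≤-trans (new<offset n k≤c) (m≤m+n (offset n) _)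

  copy₀<copy₁ : ∀ n {k r} k′ r′ → IsVertexʳ n k r →
                positionʳ (suc n) k (false ∷ r) < positionʳ (suc n) k′ (true ∷ r′)
  copy₀<copy₁ n k′ r′ v = <-trans (copy₀<new n 0 v) (new<copy₁ n k′ r′ z≤n)

  positionʳ-injective : ∀ n {k k′ r r′} → IsVertexʳ n k r → IsVertexʳ n k′ r′ →
                        positionʳ n k r ≡ positionʳ n k′ r′ → k ≡ k′ × r ≡ r′
  positionʳ-injective zero {r = []} {r′ = []} refl refl _ = refl , refl
  positionʳ-injective zero {r = []} {r′ = _ ∷ _} _ () _
  positionʳ-injective zero {r = _ ∷ _} () _ _
  positionʳ-injective (suc n) {r = []} {r′ = []} _ _ eq = +-cancelˡ-≡ (lastPos n) _ _ (suc-injective eq) , refl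
  positionʳ-injective (suc n) {r = false ∷ r} {r′ = false ∷ r′} v v′ eq with positionʳ-injective n v v′ eq
  ... | refl , refl = refl , refl
  positionʳ-injective (suc n) {r = true ∷ r} {r′ = true ∷ r′} v v′ eq
    with positionʳ-injective n v v′
           (∸-cancelˡ-≡ (positionʳ-≤ n v) (positionʳ-≤ n v′) (+-cancelˡ-≡ (offset n) _ _ eq))
  ... | refl , refl = refl , refl
  positionʳ-injective (suc n) {r = []} {r′ = false ∷ _} _ v′ eq = contradiction (sym eq) (<⇒≢ (copy₀<new n _ v′))
  positionʳ-injective (suc n) {r = []} {r′ = true ∷ _} v _ eq = contradiction eq (<⇒≢ (new<copy₁ n _ _ v))
  positionʳ-injective (suc n) {r = false ∷ _} {r′ = []} v _ eq = contradiction eq (<⇒≢ (copy₀<new n _ v))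
  positionʳ-injective (suc n) {r = false ∷ _} {r′ = true ∷ _} v _ eq = contradiction eq (<⇒≢ (copy₀<copy₁ n _ _ v))
  positionʳ-injective (suc n) {r = true ∷ _} {r′ = []} _ v′ eq = contradiction (sym eq) (<⇒≢ (new<copy₁ n _ _ v′))
  positionʳ-injective (suc n) {r = true ∷ _} {r′ = false ∷ _} _ v′ eq = contradiction (sym eq) (<⇒≢ (copy₀<copy₁ n _ _ v′))

  position-injective : ∀ {n a b} → IsVertex n a → IsVertex n b → position n a ≡ position n b → a ≡ b
  position-injective {n} va vb eq with positionʳ-injective n va vb eq
  ... | k≡k′ , r≡r′ = cong₂ _,_ k≡k′ (reverse-injective r≡r′)

  position-snoc : ∀ n a b → position (suc n) (snocV a b) ≡ positionʳ (suc n) (proj₁ a) (b ∷ reverse (proj₂ a))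
  position-snoc n (k , t) b = cong (positionʳ (suc n) k) (reverse-∷ʳ t b)

  isVertex-snoc : ∀ n a b → IsVertex n a → IsVertex (suc n) (snocV a b)
  isVertex-snoc n (k , t) b = subst (IsVertexʳ (suc n) k) (sym (reverse-∷ʳ t b))

  isVertex-e₀ : ∀ n → IsVertex n (e₀ n)
  isVertex-e₀ zero    = refl
  isVertex-e₀ (suc n) = isVertex-snoc n (e₀ n) false (isVertex-e₀ n)

  isVertex-e₁ : ∀ n → IsVertex n (e₁ n)
  isVertex-e₁ zero    = refl
  isVertex-e₁ (suc n) = isVertex-snoc n (e₀ n) true (isVertex-e₀ n)

  position-e₀ : ∀ n → position n (e₀ n) ≡ 0
  position-e₀ zero    = refl
  position-e₀ (suc n) = trans (position-snoc n (e₀ n) false) (position-e₀ n)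

  position-e₁ : ∀ n → position n (e₁ n) ≡ lastPos n
  position-e₁ zero    = refl
  position-e₁ (suc n) = trans (position-snoc n (e₀ n) true) (cong (λ p → offset n + (lastPos n ∸ p)) (position-e₀ n))

  position-e₁-false : ∀ n → position (suc n) (snocV (e₁ n) false) ≡ lastPos n
  position-e₁-false n = trans (position-snoc n (e₁ n) false) (position-e₁ n)

  position-e₁-true : ∀ n → position (suc n) (snocV (e₁ n) true) ≡ offset n
  position-e₁-true n = begin
    position (suc n) (snocV (e₁ n) true)       ≡⟨ position-snoc n (e₁ n) true ⟩
    offset n + (lastPos n ∸ position n (e₁ n)) ≡⟨ cong (λ p → offset n + (lastPos n ∸ p)) (position-e₁ n) ⟩
    offset n + (lastPos n ∸ lastPos n)         ≡⟨ cong (offset n +_) (n∸n≡0 (lastPos n)) ⟩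
    offset n + 0                               ≡⟨ +-identityʳ (offset n) ⟩
    offset n                                   ∎
    where open ≡-Reasoning

  edge-isVertex : ∀ {n a b} → Edge c n a b → IsVertex n a × IsVertex n b
  edge-isVertex (lift {n} {a} {b} e i) =
    isVertex-snoc n a i (proj₁ (edge-isVertex e)) , isVertex-snoc n b i (proj₂ (edge-isVertex e))
  edge-isVertex (pathˡ {n})            = isVertex-snoc n (e₁ n) false (isVertex-e₁ n) , z≤n
  edge-isVertex (pathᵐ j<c)            = <⇒≤ j<c , j<c
  edge-isVertex (pathʳ {n})            = ≤-refl , isVertex-snoc n (e₁ n) true (isVertex-e₁ n)

  edge-oneApart : ∀ {n a b} → Edge c n a b → OneApart (position n a) (position n b)
  edge-oneApart (lift {n} {a} {b} e false) =
    subst₂ OneApart (sym (position-snoc n a false)) (sym (position-snoc n b false)) (edge-oneApart e)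
  edge-oneApart (lift {n} {a} {b} e true) =
    subst₂ OneApart (sym (position-snoc n a true)) (sym (position-snoc n b true))
      (OneApart-+ˡ (offset n) (OneApart-∸ˡ (lastPos n) (positionʳ-≤ n va) (positionʳ-≤ n vb) (edge-oneApart e)))
    where
    va = proj₁ (edge-isVertex e)
    vb = proj₂ (edge-isVertex e)
  edge-oneApart (pathˡ {n}) =
    inj₁ (trans (cong suc (position-e₁-false n)) (cong suc (sym (+-identityʳ (lastPos n)))))
  edge-oneApart (pathᵐ {n} {j} _) = inj₁ (cong suc (sym (+-suc (lastPos n) j)))
  edge-oneApart (pathʳ {n}) = inj₁ (sym (position-e₁-true n))

  adjL-oneApart : ∀ {n a b} → AdjL c n a b → OneApart (position n a) (position n b)
  adjL-oneApart (inj₁ e) = edge-oneApart e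
  adjL-oneApart (inj₂ e) = OneApart-sym (edge-oneApart e)

  AdjL-sym : ∀ {n a b} → AdjL c n a b → AdjL c n b a
  AdjL-sym (inj₁ e) = inj₂ e
  AdjL-sym (inj₂ e) = inj₁ e

  AdjL-snoc : ∀ {n a b i j} → AdjL c n a b → i ≡ j → AdjL c (suc n) (snocV a i) (snocV b j)
  AdjL-snoc {i = i} (inj₁ e) refl = inj₁ (lift e i)
  AdjL-snoc {i = i} (inj₂ e) refl = inj₂ (lift e i)

  edge-snoc-bits : ∀ {n p q a b i j} → Edge c (suc n) p q → p ≡ snocV a i → q ≡ snocV b j → i ≡ j
  edge-snoc-bits (lift e _) p≡ q≡ =
    trans (sym (∷ʳ-injectiveʳ _ _ (cong proj₂ p≡))) (∷ʳ-injectiveʳ _ _ (cong proj₂ q≡))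
  edge-snoc-bits pathˡ      _    q≡ = contradiction (cong proj₂ q≡) ([]≢∷ʳ _ _)
  edge-snoc-bits (pathᵐ _)  p≡   _  = contradiction (cong proj₂ p≡) ([]≢∷ʳ _ _)
  edge-snoc-bits pathʳ      p≡   _  = contradiction (cong proj₂ p≡) ([]≢∷ʳ _ _)

  AdjL-snoc-bits : ∀ {n a b i j} → AdjL c (suc n) (snocV a i) (snocV b j) → i ≡ j
  AdjL-snoc-bits (inj₁ e) = edge-snoc-bits e refl refl
  AdjL-snoc-bits (inj₂ e) = sym (edge-snoc-bits e refl refl)

  attach : ℕ → Bool → ℕ
  attach n false = 0
  attach n true  = c n

  attach-≤ : ∀ n b → attach n b ≤ c n
  attach-≤ n false = z≤n
  attach-≤ n true  = ≤-refl

  attach-adj : ∀ n b → AdjL c (suc n) (snocV (e₁ n) b) (attach n b , [])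
  attach-adj n false = inj₁ pathˡ
  attach-adj n true  = inj₂ pathʳ

e₀-bits : ∀ n → e₀ n ≡ (0 , restrict zeros n)
e₀-bits zero    = refl
e₀-bits (suc n) = cong (λ e → snocV e false) (e₀-bits n)

proj₁-e₁ : ∀ n → proj₁ (e₁ n) ≡ 0
proj₁-e₁ zero    = refl
proj₁-e₁ (suc n) = cong proj₁ (e₀-bits n)

length-e₁ : ∀ n → length (proj₂ (e₁ n)) ≡ n
length-e₁ zero    = refl
length-e₁ (suc n) = begin
  length (proj₂ (e₀ n) ∷ʳ true)   ≡⟨ length-∷ʳ (proj₂ (e₀ n)) true ⟩
  suc (length (proj₂ (e₀ n)))     ≡⟨ cong (λ e → suc (length (proj₂ e))) (e₀-bits n) ⟩
  suc (length (restrict zeros n)) ≡⟨ cong suc (length-restrict zeros n) ⟩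
  suc n                           ∎
  where open ≡-Reasoning

module InfiniteGraph (c : ℕ → ℕ) where
  open FinitePath c

  -- π (suc l) u extends π l u by the bit x u (l ∸ m u).
  SameTail : ℕ → XVtx c → XVtx c → Set
  SameTail n u v = ∀ l → n ≤ l → x u (l ∸ m u) ≡ x v (l ∸ m v)

  SameTail-sym : ∀ {n} {u v : XVtx c} → SameTail n u v → SameTail n v u
  SameTail-sym t l n≤l = sym (t l n≤l)

  SameTail-trans : ∀ {n} {u v w : XVtx c} → SameTail n u v → SameTail n v w → SameTail n u w
  SameTail-trans t t′ l n≤l = trans (t l n≤l) (t′ l n≤l)

  π-self : ∀ (u : XVtx c) → π (m u) u ≡ (k u , [])
  π-self u = cong (λ d → k u , restrict (x u) d) (n∸n≡0 (m u))

  π-suc : ∀ {n} (u : XVtx c) → m u ≤ n → π (suc n) u ≡ snocV (π n u) (x u (n ∸ m u))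
  π-suc u mu≤n = cong (λ d → k u , restrict (x u) d) (+-∸-assoc 1 mu≤n)

  isVertex-own-level : ∀ (u : XVtx c) → IsVertex (m u) (k u , [])
  isVertex-own-level ⟨ zero  , _ , _ ∣ inj₁ (refl , refl) ⟩ = refl
  isVertex-own-level ⟨ zero  , _ , _ ∣ inj₂ (() , _) ⟩
  isVertex-own-level ⟨ suc _ , _ , _ ∣ inj₁ (() , _) ⟩
  isVertex-own-level ⟨ suc _ , _ , _ ∣ inj₂ (_ , k≤c) ⟩ = k≤c

  π-isVertex : ∀ {n} (u : XVtx c) → m u ≤ n → IsVertex n (π n u)
  π-isVertex u = ≥-induction (λ n → IsVertex n (π n u))
    (subst (IsVertex (m u)) (sym (π-self u)) (isVertex-own-level u))
    (λ {n} mu≤n v → subst (IsVertex (suc n)) (sym (π-suc u mu≤n)) (isVertex-snoc n (π n u) _ v))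

  π-injective : ∀ {n} (u v : XVtx c) → m u ≤ n → m v ≤ n → π n u ≡ π n v → SameTail n u v → u ≈ v
  π-injective {n} u v mu≤n mv≤n eq tail = m≡ , cong proj₁ eq , bits
    where
    open ≡-Reasoning
    d = n ∸ m u
    m≡ : m u ≡ m v
    m≡ = ∸-cancelˡ-≡ mu≤n mv≤n (begin
      n ∸ m u                                 ≡⟨ sym (length-restrict (x u) d) ⟩
      length (proj₂ (π n u))                  ≡⟨ cong (λ a → length (proj₂ a)) eq ⟩
      length (restrict (x v) (n ∸ m v))       ≡⟨ length-restrict (x v) _ ⟩
      n ∸ m v                                 ∎)
    restrict≡ : restrict (x u) d ≡ restrict (x v) d
    restrict≡ = trans (cong proj₂ eq) (cong (λ m′ → restrict (x v) (n ∸ m′)) (sym m≡))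
    bits : ∀ i → x u i ≡ x v i
    bits i with i <? d
    ... | yes i<d = restrict-agree d restrict≡ i<d
    ... | no  i≮d = begin
      x u i               ≡⟨ cong (x u) (sym (m+n∸n≡m i (m u))) ⟩
      x u (i + m u ∸ m u) ≡⟨ tail (i + m u) n≤i+mu ⟩
      x v (i + m u ∸ m v) ≡⟨ cong (λ m′ → x v (i + m′ ∸ m v)) m≡ ⟩
      x v (i + m v ∸ m v) ≡⟨ cong (x v) (m+n∸n≡m i (m v)) ⟩
      x v i               ∎
      where
      n≤i+mu : n ≤ i + m u
      n≤i+mu = subst (_≤ i + m u) (m∸n+n≡m mu≤n) (+-monoˡ-≤ (m u) (≮⇒≥ i≮d))

  positionAt : ℕ → XVtx c → ℕ
  positionAt n u = position n (π n u)

  positionAt-injective : ∀ {n} {u v : XVtx c} → m u ≤ n → m v ≤ n → SameTail n u v →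
                         positionAt n u ≡ positionAt n v → u ≈ v
  positionAt-injective {n} {u} {v} mu≤n mv≤n tail eq =
    π-injective u v mu≤n mv≤n (position-injective {n} (π-isVertex u mu≤n) (π-isVertex v mv≤n) eq) tail

  Adj⇒SameTail : ∀ {u v : XVtx c} {n} → Adj c u v → m u ⊔ m v ≤ n → SameTail n u v
  Adj⇒SameTail {u} {v} uv le l n≤l = AdjL-snoc-bits
    (subst₂ (AdjL c (suc l)) (π-suc u (≤-trans (m≤m⊔n (m u) (m v)) le′))
                             (π-suc v (≤-trans (m≤n⊔m (m u) (m v)) le′))
      (uv (suc l) (≤-trans le′ (n≤1+n l))))
    where
    le′ = ≤-trans le n≤l

  Adj⇒OneApart : ∀ {u v : XVtx c} {n} → Adj c u v → m u ⊔ m v ≤ n → OneApart (positionAt n u) (positionAt n v)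
  Adj⇒OneApart uv le = adjL-oneApart (uv _ le)

  Adj-fromLevel : ∀ {N} (u w : XVtx c) → m u ⊔ m w ≡ N → AdjL c N (π N u) (π N w) → SameTail N u w → Adj c u w
  Adj-fromLevel u w refl adj tail _ = ≥-induction (λ n → AdjL c n (π n u) (π n w)) adj step
    where
    step : ∀ {n} → m u ⊔ m w ≤ n → AdjL c n (π n u) (π n w) → AdjL c (suc n) (π (suc n) u) (π (suc n) w)
    step {n} le a = subst₂ (AdjL c (suc n)) (sym (π-suc u (≤-trans (m≤m⊔n (m u) (m w)) le)))
                                            (sym (π-suc w (≤-trans (m≤n⊔m (m u) (m w)) le)))
                           (AdjL-snoc a (tail n le))

  neighbours-≈ : ∀ {n} {v u w : XVtx c} → Adj c v u → Adj c v w → m v ≤ n → m u ≤ n → m w ≤ n →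
                 positionAt n u ≡ positionAt n w → u ≈ w
  neighbours-≈ {n} {v} {u} {w} vu vw mv≤n mu≤n mw≤n = positionAt-injective {n} {u} {w} mu≤n mw≤n
    (SameTail-trans {n} {u} {v} {w} (SameTail-sym {n} {v} {u} (Adj⇒SameTail {v} {u} vu (⊔-lub mv≤n mu≤n)))
      (Adj⇒SameTail {v} {w} vw (⊔-lub mv≤n mw≤n)))

  at-most-two-neighbours : ∀ {v u w z : XVtx c} → Adj c v u → Adj c v w → ¬ u ≈ w → Adj c v z → z ≈ u ⊎ z ≈ w
  at-most-two-neighbours {v} {u} {w} {z} vu vw u≉w vz =
    ⊎-map (same z u vz vu mz≤n mu≤n) (same z w vz vw mz≤n mw≤n)
      (OneApart-third (apart u vu mu≤n) (apart w vw mw≤n) (u≉w ∘ same u w vu vw mu≤n mw≤n) (apart z vz mz≤n))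
    where
    n = (m v ⊔ m z) ⊔ (m u ⊔ m w)
    mv≤n = ≤-trans (m≤m⊔n (m v) (m z)) (m≤m⊔n _ (m u ⊔ m w))
    mz≤n = ≤-trans (m≤n⊔m (m v) (m z)) (m≤m⊔n _ (m u ⊔ m w))
    mu≤n = ≤-trans (m≤m⊔n (m u) (m w)) (m≤n⊔m (m v ⊔ m z) _)
    mw≤n = ≤-trans (m≤n⊔m (m u) (m w)) (m≤n⊔m (m v ⊔ m z) _)
    apart : ∀ y → Adj c v y → m y ≤ n → OneApart (positionAt n v) (positionAt n y)
    apart y vy my≤n = Adj⇒OneApart {v} {y} vy (⊔-lub mv≤n my≤n)
    same : ∀ y y′ → Adj c v y → Adj c v y′ → m y ≤ n → m y′ ≤ n →
           positionAt n y ≡ positionAt n y′ → y ≈ y′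
    same y y′ vy vy′ = neighbours-≈ {n} {v} {y} {y′} vy vy′ mv≤n

  positionAt-base : ∀ n → positionAt n base ≡ 0
  positionAt-base n = trans (cong (position n) (sym (e₀-bits n))) (position-e₀ n)

  base-neighbours-≈ : ∀ {u z : XVtx c} → Adj c base u → Adj c base z → z ≈ u
  base-neighbours-≈ {u} {z} bu bz =
    neighbours-≈ {n} {base} {z} {u} bz bu z≤n mz≤n mu≤n (trans (at-1 z bz mz≤n) (sym (at-1 u bu mu≤n)))
    where
    n = m z ⊔ m u
    mz≤n = m≤m⊔n (m z) (m u)
    mu≤n = m≤n⊔m (m z) (m u)
    at-1 : ∀ y → Adj c base y → m y ≤ n → positionAt n y ≡ 1
    at-1 y by my≤n = OneApart-0
      (subst (λ p → OneApart p (positionAt n y)) (positionAt-base n) (Adj⇒OneApart {base} {y} by my≤n))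

  origin : Cantor → XVtx c
  origin z = ⟨ 0 , 0 , z ∣ inj₁ (refl , refl) ⟩

  π-origin-e₁ : ∀ {z j} → (∀ {l} → l < j → z l ≡ false) → z j ≡ true → π (suc j) (origin z) ≡ e₁ (suc j)
  π-origin-e₁ {z} {j} below zj =
    trans (cong₂ (λ t b → 0 , t ∷ʳ b) (restrict-cong j below) zj) (cong (λ e → snocV e true) (sym (e₀-bits j)))

  -- The neighbours are found at level 1 and at the level just after the first 1 of z.
  two-neighbours-origin : ∀ z i → z i ≡ true → ∃[ u ] ∃[ w ] Adj c (origin z) u × Adj c (origin z) w × ¬ u ≈ w
  two-neighbours-origin z i zi with first-true z i zi
  ... | j , zj , below = u₁ , u₂ , adj₁ , adj₂ , λ { (() , _) }
    where
    u₁ u₂ : XVtx c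
    u₁ = ⟨ 1 , attach 0 (z 0) , (λ l → z (suc l)) ∣ inj₂ (s≤s z≤n , attach-≤ 0 (z 0)) ⟩
    u₂ = ⟨ suc (suc j) , attach (suc j) (z (suc j)) , (λ l → z (suc (suc j) + l))
         ∣ inj₂ (s≤s z≤n , attach-≤ (suc j) (z (suc j))) ⟩
    adj₁ : Adj c (origin z) u₁
    adj₁ = Adj-fromLevel (origin z) u₁ refl (attach-adj 0 (z 0)) λ { zero () ; (suc l) _ → refl }
    π-origin : π (suc (suc j)) (origin z) ≡ snocV (e₁ (suc j)) (z (suc j))
    π-origin = trans (π-suc (origin z) z≤n) (cong (λ e → snocV e (z (suc j))) (π-origin-e₁ below zj))
    adj₂ : Adj c (origin z) u₂
    adj₂ = Adj-fromLevel (origin z) u₂ refl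
      (subst₂ (AdjL c (suc (suc j))) (sym π-origin) (sym (π-self u₂)) (attach-adj (suc j) (z (suc j))))
      (λ l le → cong z (sym (m+[n∸m]≡n le)))

  module AtLevel (n₀ : ℕ) (z : Cantor) where

    at : (k : ℕ) → k ≤ c n₀ → XVtx c
    at k k≤c = ⟨ suc n₀ , k , z ∣ inj₂ (s≤s z≤n , k≤c) ⟩

    through : Bool → XVtx c
    through b = origin (prepend (proj₂ (e₁ n₀) ∷ʳ b) z)

    length-through : ∀ b → length (proj₂ (e₁ n₀) ∷ʳ b) ≡ suc n₀
    length-through b = trans (length-∷ʳ (proj₂ (e₁ n₀)) b) (cong suc (length-e₁ n₀))

    π-through : ∀ b → π (suc n₀) (through b) ≡ snocV (e₁ n₀) b
    π-through b = begin
      π (suc n₀) (through b)                     ≡⟨ cong (λ d → 0 , restrict (prepend t z) d) (sym (length-through b)) ⟩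
      (0 , restrict (prepend t z) (length t))    ≡⟨ cong (0 ,_) (restrict-prepend t z) ⟩
      (0 , t)                                    ≡⟨ cong (_, t) (sym (proj₁-e₁ n₀)) ⟩
      snocV (e₁ n₀) b                            ∎
      where
      open ≡-Reasoning
      t = proj₂ (e₁ n₀) ∷ʳ b

    through-bit : ∀ b → x (through b) n₀ ≡ b
    through-bit b =
      subst (λ d → prepend (proj₂ (e₁ n₀) ∷ʳ b) z d ≡ b) (length-e₁ n₀) (prepend-∷ʳ (proj₂ (e₁ n₀)) b z)

    SameTail-through : ∀ k k≤c b → SameTail (suc n₀) (at k k≤c) (through b)
    SameTail-through k k≤c b l le =
      sym (trans (prepend-≥ t z (subst (_≤ l) (sym len) le)) (cong (λ d → z (l ∸ d)) len))
      where
      t = proj₂ (e₁ n₀) ∷ʳ b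
      len = length-through b

    adj-through : ∀ k k≤c b → k ≡ attach n₀ b → Adj c (at k k≤c) (through b)
    adj-through k k≤c b refl = Adj-fromLevel (at k k≤c) (through b) refl
      (subst₂ (AdjL c (suc n₀)) (sym (π-self (at k k≤c))) (sym (π-through b)) (AdjL-sym (attach-adj n₀ b)))
      (SameTail-through k k≤c b)

    adj-at : ∀ {k k′} k≤c k′≤c → AdjL c (suc n₀) (k , []) (k′ , []) → Adj c (at k k≤c) (at k′ k′≤c)
    adj-at {k} {k′} k≤c k′≤c a = Adj-fromLevel (at k k≤c) (at k′ k′≤c) (⊔-idem (suc n₀))
      (subst₂ (AdjL c (suc n₀)) (sym (π-self (at k k≤c))) (sym (π-self (at k′ k′≤c))) a)
      (λ _ _ → refl)

    -- At level suc n₀ the new path p_0, …, p_{c n₀} is joined to e^{n₀}_1 ⌢ false at p_0 and to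
    -- e^{n₀}_1 ⌢ true at p_{c n₀}.
    left right : (k : ℕ) → k ≤ c n₀ → XVtx c
    left zero    _   = through false
    left (suc k) k<c = at k (<⇒≤ k<c)
    right k k≤c with k <? c n₀
    ... | yes k<c = at (suc k) k<c
    ... | no  _   = through true

    adj-left : ∀ k k≤c → Adj c (at k k≤c) (left k k≤c)
    adj-left zero    k≤c = adj-through zero k≤c false refl
    adj-left (suc k) k<c = adj-at k<c (<⇒≤ k<c) (inj₂ (pathᵐ k<c))

    adj-right : ∀ k k≤c → Adj c (at k k≤c) (right k k≤c)
    adj-right k k≤c with k <? c n₀
    ... | yes k<c = adj-at k≤c k<c (inj₁ (pathᵐ k<c))
    ... | no  k≮c = adj-through k k≤c true (≤-antisym k≤c (≮⇒≥ k≮c))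

    left≉right : ∀ k k≤c → ¬ left k k≤c ≈ right k k≤c
    left≉right k k≤c with k <? c n₀
    left≉right zero    _ | yes _ = λ { (() , _) }
    left≉right (suc k) _ | yes _ = λ (_ , k≡k+2 , _) → <⇒≢ (s≤s (n≤1+n k)) k≡k+2
    left≉right zero    _ | no  _ = λ (_ , _ , bits) →
      contradiction (trans (sym (through-bit false)) (trans (bits n₀) (through-bit true))) λ ()
    left≉right (suc k) _ | no  _ = λ { (() , _) }

  two-neighbours : ∀ v → v # base → ∃[ u ] ∃[ w ] Adj c v u × Adj c v w × ¬ u ≈ w
  two-neighbours ⟨ zero  , _ , _ ∣ inj₂ (() , _) ⟩ _
  two-neighbours ⟨ suc _ , _ , _ ∣ inj₁ (() , _) ⟩ _
  two-neighbours ⟨ zero , zero , _ ∣ inj₁ (refl , refl) ⟩ (inj₁ 0≢0)        = contradiction refl 0≢0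
  two-neighbours ⟨ zero , zero , _ ∣ inj₁ (refl , refl) ⟩ (inj₂ (inj₁ 0≢0)) = contradiction refl 0≢0
  two-neighbours ⟨ zero , zero , z ∣ inj₁ (refl , refl) ⟩ (inj₂ (inj₂ (i , zi≢false))) =
    two-neighbours-origin z i (¬-not zi≢false)
  two-neighbours ⟨ suc n₀ , k , z ∣ inj₂ (s≤s z≤n , k≤c) ⟩ _ =
    left k k≤c , right k k≤c , adj-left k k≤c , adj-right k k≤c , left≉right k k≤c
    where open AtLevel n₀ z

  degree2 : ∀ v → v # base → Degree2 c v
  degree2 v v#base with two-neighbours v v#base
  ... | u , w , vu , vw , u≉w =
    u , w , vu , vw , u≉w , λ z → at-most-two-neighbours {v} {u} {w} {z} vu vw u≉w

  degree1-base : Degree1 c base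
  degree1-base = u , bu , λ z bz → base-neighbours-≈ {u} {z} bu bz
    where
    u : XVtx c
    u = ⟨ 1 , 0 , zeros ∣ inj₂ (s≤s z≤n , z≤n) ⟩
    bu : Adj c base u
    bu = Adj-fromLevel base u refl (attach-adj 0 false) λ { zero () ; (suc l) _ → refl }

  no-cycle : ¬ HasCycle c
  -- At a level N above all cycle vertices they share the tail of f 0, so their positions at N differ.
  no-cycle (suc L , f , 3≤L , step , close , distinct) = revisit walk
    where
    N : ℕ
    N = m (f (proj₁ (argmax (m ∘ f) L)))
    below : ∀ i → i < suc L → m (f i) ≤ N
    below = proj₂ (proj₂ (argmax (m ∘ f) L))
    tail₀ : ∀ i → i < suc L → SameTail N (f 0) (f i)
    tail₀ zero    _   _ _ = refl
    tail₀ (suc i) i<L = SameTail-trans {N} {f 0} {f i} {f (suc i)} (tail₀ i (<⇒≤ i<L))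
      (Adj⇒SameTail {f i} {f (suc i)} (step i i<L) (⊔-lub (below i (<⇒≤ i<L)) (below (suc i) i<L)))
    walk : ∃[ i ] ∃[ j ] i < j × j < suc L × positionAt N (f i) ≡ positionAt N (f j)
    walk = closed-walk-revisits (positionAt N ∘ f) 3≤L
      (λ i i<L → Adj⇒OneApart {f i} {f (suc i)} (step i i<L) (⊔-lub (below i (<⇒≤ i<L)) (below (suc i) i<L)))
      (Adj⇒OneApart {f L} {f 0} close (⊔-lub (below L ≤-refl) (below 0 (s≤s z≤n))))
    revisit : (∃[ i ] ∃[ j ] i < j × j < suc L × positionAt N (f i) ≡ positionAt N (f j)) → ⊥
    revisit (i , j , i<j , j<L , eq) = distinct i j i<j j<L
      (positionAt-injective {N} {f i} {f j} (below i (<-trans i<j j<L)) (below j j<L)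
        (SameTail-trans {N} {f i} {f 0} {f j} (SameTail-sym {N} {f 0} {f i} (tail₀ i (<-trans i<j j<L)))
                                              (tail₀ j j<L))
        eq)

lemma4p1 : (c : ℕ → ℕ) →
    ¬ HasCycle c
    × (∀ (v : XVtx c) → v # base → Degree2 c v)
    × Degree1 c base
lemma4p1 c = no-cycle , degree2 , degree1-base
  where open InfiniteGraph c
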